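{- Let $T$ be a tree of order $n\geq 2$ and let $F\subseteq V(T)$ be a minimal fort of $T$. Let $u,v\in F$ and let $W=\{w_{0},w_{1},\ldots,w_{\ell}\}$ be the vertex set of the unique path from $u$ to $v$ in $T$. Then the induced subgraph $T[W]$ is a path graph of order $\ell+1$, and $F\cap W$ is a minimal fort of $T[W]$.
   Context: A fort of a finite simple graph $G=(V,E)$ is a non-empty subset $F\subseteq V$ such that no vertex $u\in V\setminus F$ has exactly one neighbor in $F$; a fort is minimal if no proper subset of it is a fort. -}

module Defs where

open import Data.Nat using (ℕ; zero; suc; _≤_)
open import Data.Bool using (Bool; true; false)
open import Data.Fin using (Fin; zero; suc; toℕ; fromℕ; inject₁)
open import Data.Fin.Subset using (Subset; _∈_; _∉_; _⊂_; _∩_; ∣_∣; Nonempty)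
open import Data.Fin.Permutation using (Permutation′; _⟨$⟩ʳ_)
open import Data.Vec using (tabulate; lookup)
open import Data.Product using (Σ; ∃; _×_)
open import Data.Sum using (_⊎_)
open import Data.Empty using (⊥)
open import Relation.Nullary using (¬_)
open import Relation.Binary.PropositionalEquality using (_≡_; _≢_; refl)
open import Function.Definitions using (Injective)
open import Function.Bundles using (_⇔_)

record Graph (n : ℕ) : Set where
  field
    adj    : Fin n → Fin n → Bool
    sym    : ∀ i j → adj i j ≡ adj j i
    irrefl : ∀ i → adj i i ≡ false
open Graph public

nbhd : ∀ {n} → Graph n → Fin n → Subset n
nbhd G u = tabulate (adj G u)

IsFort : ∀ {n} → Graph n → Subset n → Set
IsFort G F = Nonempty F × (∀ u → u ∉ F → ∣ nbhd G u ∩ F ∣ ≢ 1)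

IsMinimalFort : ∀ {n} → Graph n → Subset n → Set
IsMinimalFort G F = IsFort G F × (∀ F′ → F′ ⊂ F → ¬ IsFort G F′)

IsPath : ∀ {n} → Graph n → Fin n → Fin n → (ℓ : ℕ) → (Fin (suc ℓ) → Fin n) → Set
IsPath G u v ℓ w =
  Injective _≡_ _≡_ w × w zero ≡ u × w (fromℕ ℓ) ≡ v ×
  (∀ (i : Fin ℓ) → adj G (w (inject₁ i)) (w (suc i)) ≡ true)

IsCycle : ∀ {n} → Graph n → (ℓ : ℕ) → (Fin (suc ℓ) → Fin n) → Set
IsCycle G ℓ w =
  2 ≤ ℓ × Injective _≡_ _≡_ w ×
  (∀ (i : Fin ℓ) → adj G (w (inject₁ i)) (w (suc i)) ≡ true) ×
  adj G (w (fromℕ ℓ)) (w zero) ≡ true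

Connected : ∀ {n} → Graph n → Set
Connected G = ∀ u v → Σ ℕ λ ℓ → Σ (Fin (suc ℓ) → _) λ w → IsPath G u v ℓ w

Acyclic : ∀ {n} → Graph n → Set
Acyclic G = ∀ ℓ w → ¬ IsCycle G ℓ w

IsTree : ∀ {n} → Graph n → Set
IsTree G = Connected G × Acyclic G

-- Induced subgraph on the vertices f 0, …, f (m-1) (f injective in use),
-- with vertex i of the new graph standing for f i.
induced : ∀ {m n} → Graph n → (Fin m → Fin n) → Graph m
induced G f = record
  { adj = λ i j → adj G (f i) (f j)
  ; sym = λ i j → sym G (f i) (f j)
  ; irrefl = λ i → irrefl G (f i) }

restrict : ∀ {m n} → Subset n → (Fin m → Fin n) → Subset m
restrict F f = tabulate (λ i → lookup F (f i))

IsPathGraph : ∀ {m} → Graph m → Set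
IsPathGraph {m} G = Σ (Permutation′ m) λ σ → ∀ i j →
  (adj G (σ ⟨$⟩ʳ i) (σ ⟨$⟩ʳ j) ≡ true) ⇔ (suc (toℕ i) ≡ toℕ j ⊎ suc (toℕ j) ≡ toℕ i)

{-# OPTIONS --safe #-}
module Submission where

-- Deleting an edge xy of a forest separates the side of x from the side of y, and xy is the only
-- edge between them.  Let F be a minimal fort.  (a) If x, y ∉ F, then F lies on one side: otherwise
-- F ∩ (side of y) is a smaller fort.  (b) A vertex x ∈ F has at most one neighbour in F: if a ≠ c
-- were two, F ∩ (side of a ∪ side of c) would be a smaller fort, x having both a and c as
-- neighbours in it.  The u–v path is an induced path because the graph is acyclic, and u, v lie on
-- opposite sides of each of its edges; so by (a) no two consecutive vertices of the path miss F,
-- and by (b) no three consecutive ones lie in F.  On a path, a set containing both ends without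
-- two consecutive non-members is a fort, and a fort without three consecutive members is
-- minimal, since a vertex outside a smaller fort needs fort neighbours on both sides.

open import Defs
open import Data.Nat using (ℕ; suc; _≤_)
open import Data.Fin using (Fin)
open import Data.Fin.Subset using (Subset; _∈_)
open import Data.Product using (_×_)

open import Data.Bool.Base using (Bool; true)
open import Data.Empty using (⊥; ⊥-elim)
import Data.Fin.Base as Fin
open import Data.Fin.Base using (zero; suc; toℕ; inject₁)
import Data.Fin.Permutation as Permutation
open import Data.Fin.Properties
  using (_≟_; toℕ-injective; toℕ-inject₁; toℕ-fromℕ; toℕ-fromℕ<; toℕ-lower₁; toℕ≤pred[n]; ≤fromℕ)
open import Data.Fin.Subset using (_∉_; _⊂_; _∩_; ∣_∣; Nonempty; ⁅_⁆; inside; outside)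
  renaming (⊥ to ∅)
open import Data.Fin.Subset.Properties
  using (_∈?_; x∈⁅x⁆; x∈⁅y⁆⇒x≡y; ∣⁅x⁆∣≡1; ⊆-antisym; p∩q⊆p; x∈p∩q⁺; x∈p∩q⁻)
import Data.Nat.Base as ℕ
open import Data.Nat.Base using (z≤n; s≤s; _+_; _∸_)
import Data.Nat.Properties as ℕₚ
open import Data.Nat.Properties using (suc-injective)
open import Data.Product using (∃; _,_; proj₁; proj₂)
open import Data.Sum using (_⊎_; inj₁; inj₂; [_,_])
open import Data.Vec.Base using (Vec; []; _∷_; tabulate; lookup)
open import Data.Vec.Membership.Propositional using () renaming (_∈_ to _∈ᵥ_)
open import Data.Vec.Properties using (lookup∘tabulate; []=⇒lookup; lookup⇒[]=)
open import Data.Vec.Relation.Unary.All using (All; []; _∷_)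
open import Data.Vec.Relation.Unary.AllPairs using ([]; _∷_)
open import Data.Vec.Relation.Unary.Any using (Any; here; there; any?)
open import Data.Vec.Relation.Unary.Unique.Propositional using (Unique)
open import Data.Vec.Relation.Unary.Unique.Propositional.Properties using (lookup-injective)
open import Function.Base using (_∘_)
open import Function.Bundles using (_⇔_; mk⇔; Equivalence)
open import Function.Definitions using (Injective)
open import Level using (0ℓ)
open import Relation.Binary.Definitions using (tri<; tri≈; tri>)
open import Relation.Binary.PropositionalEquality using (_≡_; _≢_; refl; trans; cong; subst)
import Relation.Binary.PropositionalEquality as ≡
open import Relation.Nullary using (¬_; yes; no; does)
open import Relation.Nullary.Decidable using (dec-true; decidable-stable; _⊎-dec_)
open import Relation.Nullary.Decidable.Core using (¬¬-excluded-middle)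
open import Relation.Unary using (Pred; Decidable)

∈-tabulate⁺ : ∀ {n} {f : Fin n → Bool} {i} → f i ≡ true → i ∈ tabulate f
∈-tabulate⁺ {f = f} {i} fi = lookup⇒[]= i (tabulate f) (trans (lookup∘tabulate f i) fi)

∈-tabulate⁻ : ∀ {n} {f : Fin n → Bool} {i} → i ∈ tabulate f → f i ≡ true
∈-tabulate⁻ {f = f} {i} i∈ = trans (≡.sym (lookup∘tabulate f i)) ([]=⇒lookup i∈)

subset : ∀ {n} {P : Pred (Fin n) 0ℓ} → Decidable P → Subset n
subset P? = tabulate (does ∘ P?)

∈-subset⁺ : ∀ {n} {P : Pred (Fin n) 0ℓ} (P? : Decidable P) {i} → P i → i ∈ subset P?
∈-subset⁺ P? {i} p = ∈-tabulate⁺ (dec-true (P? i) p)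

∈-subset⁻ : ∀ {n} {P : Pred (Fin n) 0ℓ} (P? : Decidable P) {i} → i ∈ subset P? → P i
∈-subset⁻ P? {i} i∈ with P? i | ∈-tabulate⁻ {f = does ∘ P?} i∈
... | yes p | _ = p
... | no _  | ()

∣p∣≡0⇒p≡∅ : ∀ {n} (p : Subset n) → ∣ p ∣ ≡ 0 → p ≡ ∅
∣p∣≡0⇒p≡∅ []            _  = refl
∣p∣≡0⇒p≡∅ (outside ∷ p) eq = cong (outside ∷_) (∣p∣≡0⇒p≡∅ p eq)

∣p∣≡1⇒p≡⁅x⁆ : ∀ {n} (p : Subset n) → ∣ p ∣ ≡ 1 → ∃ λ x → p ≡ ⁅ x ⁆
∣p∣≡1⇒p≡⁅x⁆ (inside ∷ p)  eq = zero , cong (inside ∷_) (∣p∣≡0⇒p≡∅ p (suc-injective eq))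
∣p∣≡1⇒p≡⁅x⁆ (outside ∷ p) eq with ∣p∣≡1⇒p≡⁅x⁆ p eq
... | x , p≡⁅x⁆ = suc x , cong (outside ∷_) p≡⁅x⁆

∈-restrict⁺ : ∀ {m n} {F : Subset n} (f : Fin m → Fin n) {i} → f i ∈ F → i ∈ restrict F f
∈-restrict⁺ _ fi∈F = ∈-tabulate⁺ ([]=⇒lookup fi∈F)

∈-restrict⁻ : ∀ {m n} {F : Subset n} (f : Fin m → Fin n) {i} → i ∈ restrict F f → f i ∈ F
∈-restrict⁻ {F = F} f {i} i∈ = lookup⇒[]= (f i) F (∈-tabulate⁻ i∈)

∩-⊂ : ∀ {n} {p q : Subset n} {x} → x ∈ p → x ∉ q → p ∩ q ⊂ p
∩-⊂ {p = p} {q} {x} x∈p x∉q = p∩q⊆p p q , x , x∈p , x∉q ∘ proj₂ ∘ x∈p∩q⁻ p q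

-- Sides of an edge are not decidable here, but every use of them has a negative goal.
¬¬-decidable : ∀ {n} (P : Pred (Fin n) 0ℓ) → ¬ ¬ Decidable P
¬¬-decidable {ℕ.zero}  P k = k λ ()
¬¬-decidable {suc n} P k = ¬¬-decidable (P ∘ suc) λ P∘suc? → ¬¬-excluded-middle λ P0? →
  k λ { zero → P0? ; (suc i) → P∘suc? i }

module _ {n} (G : Graph n) where

  adj-sym : ∀ {a b} → adj G a b ≡ true → adj G b a ≡ true
  adj-sym {a} {b} ab = trans (sym G b a) ab

  adj⇒≢ : ∀ {a b} → adj G a b ≡ true → a ≢ b
  adj⇒≢ {a} ab refl with trans (≡.sym ab) (irrefl G a)
  ... | ()

  ∈-nbhd⁺ : ∀ {z a} → adj G z a ≡ true → a ∈ nbhd G z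
  ∈-nbhd⁺ = ∈-tabulate⁺

  ∈-nbhd⁻ : ∀ {z a} → a ∈ nbhd G z → adj G z a ≡ true
  ∈-nbhd⁻ = ∈-tabulate⁻

  OnlyNeighbourIn : Subset n → Fin n → Fin n → Set
  OnlyNeighbourIn S z a =
    a ∈ S × adj G z a ≡ true × (∀ {b} → b ∈ S → adj G z b ≡ true → b ≡ a)

  onlyNeighbour⇒∣nbhd∩∣≡1 : ∀ {S z a} → OnlyNeighbourIn S z a → ∣ nbhd G z ∩ S ∣ ≡ 1
  onlyNeighbour⇒∣nbhd∩∣≡1 {S} {z} {a} (a∈S , za , only) =
    trans (cong ∣_∣ (⊆-antisym ⊆⁅a⁆ ⁅a⁆⊆)) (∣⁅x⁆∣≡1 a)
    where
    ⊆⁅a⁆ : ∀ {b} → b ∈ nbhd G z ∩ S → b ∈ ⁅ a ⁆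
    ⊆⁅a⁆ {b} b∈ with x∈p∩q⁻ (nbhd G z) S b∈
    ... | b∈N , b∈S = subst (_∈ ⁅ a ⁆) (≡.sym (only b∈S (∈-nbhd⁻ b∈N))) (x∈⁅x⁆ a)
    ⁅a⁆⊆ : ∀ {b} → b ∈ ⁅ a ⁆ → b ∈ nbhd G z ∩ S
    ⁅a⁆⊆ b∈ rewrite x∈⁅y⁆⇒x≡y a b∈ = x∈p∩q⁺ (∈-nbhd⁺ za , a∈S)

  ∣nbhd∩∣≡1⇒onlyNeighbour : ∀ {S z} → ∣ nbhd G z ∩ S ∣ ≡ 1 → ∃ (OnlyNeighbourIn S z)
  ∣nbhd∩∣≡1⇒onlyNeighbour {S} {z} eq with ∣p∣≡1⇒p≡⁅x⁆ (nbhd G z ∩ S) eq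
  ... | a , N∩S≡⁅a⁆ = a , a∈S , ∈-nbhd⁻ a∈N , only
    where
    a∈N∩S = subst (a ∈_) (≡.sym N∩S≡⁅a⁆) (x∈⁅x⁆ a)
    a∈N = proj₁ (x∈p∩q⁻ (nbhd G z) S a∈N∩S)
    a∈S = proj₂ (x∈p∩q⁻ (nbhd G z) S a∈N∩S)
    only : ∀ {b} → b ∈ S → adj G z b ≡ true → b ≡ a
    only b∈S zb = x∈⁅y⁆⇒x≡y a (subst (_ ∈_) N∩S≡⁅a⁆ (x∈p∩q⁺ (∈-nbhd⁺ zb , b∈S)))

  fort⇒¬onlyNeighbour : ∀ {S z a} → IsFort G S → z ∉ S → ¬ OnlyNeighbourIn S z a
  fort⇒¬onlyNeighbour (_ , fort) z∉S = fort _ z∉S ∘ onlyNeighbour⇒∣nbhd∩∣≡1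

  ¬onlyNeighbour⇒fort : ∀ {S} → Nonempty S →
    (∀ {z a} → z ∉ S → ¬ OnlyNeighbourIn S z a) → IsFort G S
  ¬onlyNeighbour⇒fort nonempty ¬only =
    nonempty , λ z z∉S → ¬only z∉S ∘ proj₂ ∘ ∣nbhd∩∣≡1⇒onlyNeighbour

  fort-∩ : ∀ {F S} → IsFort G F → Nonempty (F ∩ S) →
    (∀ {z z′} → z ∈ S → z′ ∉ S → adj G z z′ ≡ true → z′ ∈ F → z ∈ F) →
    (∀ {z a} → z ∉ S → ¬ OnlyNeighbourIn (F ∩ S) z a) →
    IsFort G (F ∩ S)
  fort-∩ {F} {S} fort nonempty boundary exterior = ¬onlyNeighbour⇒fort nonempty ¬only
    where
    ¬only : ∀ {z a} → z ∉ F ∩ S → ¬ OnlyNeighbourIn (F ∩ S) z a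
    ¬only {z} z∉F∩S with z ∈? S
    ... | no z∉S = exterior z∉S
    ... | yes z∈S = λ (a∈F∩S , za , only) →
      fort⇒¬onlyNeighbour fort z∉F (proj₁ (x∈p∩q⁻ F S a∈F∩S) , za , λ b∈F zb →
        only (x∈p∩q⁺ (b∈F , ∈S b∈F zb)) zb)
      where
      z∉F : z ∉ F
      z∉F z∈F = z∉F∩S (x∈p∩q⁺ (z∈F , z∈S))
      ∈S : ∀ {b} → b ∈ F → adj G z b ≡ true → b ∈ S
      ∈S {b} b∈F zb with b ∈? S
      ... | yes b∈S = b∈S
      ... | no b∉S = ⊥-elim (z∉F (boundary z∈S b∉S zb b∈F))

data WalkTo {n} (G : Graph n) (y : Fin n) : ∀ {m} → Vec (Fin n) (suc m) → Set where
  stop : WalkTo G y (y ∷ [])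
  step : ∀ {m a b} {vs : Vec (Fin n) m} →
    adj G a b ≡ true → WalkTo G y (b ∷ vs) → WalkTo G y (a ∷ b ∷ vs)

module _ {n} {G : Graph n} {y : Fin n} where

  walk-adj : ∀ {m} {vs : Vec (Fin n) (suc m)} → WalkTo G y vs →
    ∀ (i : Fin m) → adj G (lookup vs (inject₁ i)) (lookup vs (suc i)) ≡ true
  walk-adj (step ab _)    zero    = ab
  walk-adj (step _ walk) (suc i) = walk-adj walk i

  walk-last : ∀ {m} {vs : Vec (Fin n) (suc m)} → WalkTo G y vs → lookup vs (Fin.fromℕ m) ≡ y
  walk-last stop          = refl
  walk-last (step _ walk) = walk-last walk

  acyclic⇒¬closingEdge : Acyclic G → ∀ {x a b m} {vs : Vec (Fin n) m} →
    WalkTo G y (x ∷ a ∷ b ∷ vs) → Unique (x ∷ a ∷ b ∷ vs) → adj G y x ≢ true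
  acyclic⇒¬closingEdge acyclic {x} walk unique yx = acyclic _ (lookup (_ ∷ _ ∷ _ ∷ _))
    ( s≤s (s≤s z≤n)
    , (λ {i} {j} → lookup-injective unique i j)
    , walk-adj walk
    , subst (λ v → adj G v x ≡ true) (≡.sym (walk-last walk)) yx )

¬Any⇒All¬ : ∀ {a p} {A : Set a} {P : Pred A p} {m} {xs : Vec A m} → ¬ Any P xs → All (¬_ ∘ P) xs
¬Any⇒All¬ {xs = []}     _    = []
¬Any⇒All¬ {xs = x ∷ xs} ¬any = ¬any ∘ here ∷ ¬Any⇒All¬ (¬any ∘ there)

module Sides {n} (G : Graph n) (acyclic : Acyclic G) {x y : Fin n} (xy : adj G x y ≡ true) where

  -- Side z: z is joined to y by a path avoiding x (Unique (x ∷ z ∷ vs) says both), i.e. z lies in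
  -- the component of y in G − xy.
  data Side (z : Fin n) : Set where
    side : ∀ {m} (vs : Vec (Fin n) m) → WalkTo G y (z ∷ vs) → Unique (x ∷ z ∷ vs) → Side z

  side-y : Side y
  side-y = side [] stop ((adj⇒≢ G xy ∷ []) ∷ [] ∷ [])

  ¬side-x : ¬ Side x
  ¬side-x (side _ _ ((x≢x ∷ _) ∷ _)) = x≢x refl

  private
    side-suffix : ∀ {z m} {vs : Vec (Fin n) (suc m)} →
      z ∈ᵥ vs → WalkTo G y vs → Unique (x ∷ vs) → Side z
    side-suffix (here refl) walk          unique                   = side _ walk unique
    side-suffix (there ())  stop          _
    side-suffix (there z∈)  (step _ walk) ((_ ∷ x∉) ∷ _ ∷ unique) =
      side-suffix z∈ walk (x∉ ∷ unique)

  side-step : ∀ {z z′} → Side z → adj G z z′ ≡ true → z′ ≢ x → Side z′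
  side-step {z} {z′} (side vs walk (x∉ ∷ unique)) zz′ z′≢x with any? (z′ ≟_) (z ∷ vs)
  ... | yes z′∈ = side-suffix z′∈ walk (x∉ ∷ unique)
  ... | no z′∉  = side (z ∷ vs) (step (adj-sym G zz′) walk)
                       ((z′≢x ∘ ≡.sym ∷ x∉) ∷ ¬Any⇒All¬ z′∉ ∷ unique)

  side-adj-x : ∀ {z} → Side z → adj G z x ≡ true → z ≡ y
  side-adj-x (side []      stop _)      _  = refl
  side-adj-x (side (_ ∷ _) walk unique) zx =
    ⊥-elim (acyclic⇒¬closingEdge acyclic (step (adj-sym G zx) walk) unique (adj-sym G xy))

  crossing : ∀ {z z′} → Side z → ¬ Side z′ → adj G z z′ ≡ true → z′ ≡ x × z ≡ y
  crossing {z} {z′} side-z ¬side-z′ zz′ with z′ ≟ x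
  ... | yes refl = refl , side-adj-x side-z zz′
  ... | no z′≢x  = ⊥-elim (¬side-z′ (side-step side-z zz′ z′≢x))

module _ {n} (G : Graph n) (acyclic : Acyclic G) {F : Subset n} (minimal : IsMinimalFort G F) where

  private
    fort = proj₁ minimal

  minimalFort-side : ∀ {x y u v} (xy : adj G x y ≡ true) → x ∉ F → y ∉ F → u ∈ F → v ∈ F →
    ¬ Sides.Side G acyclic xy u → ¬ Sides.Side G acyclic xy v
  minimalFort-side {v = v} xy x∉F y∉F u∈F v∈F ¬side-u side-v =
    ¬¬-decidable Side λ side? → let open Restricted side? in
    proj₂ minimal (F ∩ S) (∩-⊂ u∈F (¬side-u ∘ ∈-subset⁻ side?)) smaller-fort
    where
    open Sides G acyclic xy
    module Restricted (side? : Decidable Side) where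
      S = subset side?
      boundary : ∀ {z z′} → z ∈ S → z′ ∉ S → adj G z z′ ≡ true → z′ ∈ F → z ∈ F
      boundary z∈S z′∉S zz′ z′∈F = ⊥-elim (x∉F (subst (_∈ F) z′≡x z′∈F))
        where
        z′≡x = proj₁ (crossing (∈-subset⁻ side? z∈S) (z′∉S ∘ ∈-subset⁺ side?) zz′)
      exterior : ∀ {z a} → z ∉ S → ¬ OnlyNeighbourIn G (F ∩ S) z a
      exterior z∉S (a∈F∩S , za , _) with x∈p∩q⁻ F S a∈F∩S
      ... | a∈F , a∈S = y∉F (subst (_∈ F) a≡y a∈F)
        where
        a≡y = proj₂ (crossing (∈-subset⁻ side? a∈S) (z∉S ∘ ∈-subset⁺ side?) (adj-sym G za))
      smaller-fort : IsFort G (F ∩ S)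
      smaller-fort = fort-∩ G fort (v , x∈p∩q⁺ (v∈F , ∈-subset⁺ side? side-v)) boundary exterior

  minimalFort-neighbour-unique : ∀ {x a c} → x ∈ F → a ∈ F → c ∈ F →
    adj G x a ≡ true → adj G x c ≡ true → a ≡ c
  minimalFort-neighbour-unique {x} {a} {c} x∈F a∈F c∈F xa xc =
    decidable-stable (a ≟ c) λ a≢c →
    ¬¬-decidable A.Side λ a-side? → ¬¬-decidable C.Side λ c-side? →
    let open Restricted a-side? c-side? in
    proj₂ minimal (F ∩ S) (∩-⊂ x∈F x∉S) (smaller-fort a≢c)
    where
    module A = Sides G acyclic xa
    module C = Sides G acyclic xc
    module Restricted (a-side? : Decidable A.Side) (c-side? : Decidable C.Side) where
      S? : Decidable (λ z → A.Side z ⊎ C.Side z)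
      S? z = a-side? z ⊎-dec c-side? z
      S = subset S?
      x∉S : x ∉ S
      x∉S x∈S = [ A.¬side-x , C.¬side-x ] (∈-subset⁻ S? x∈S)
      a∈F∩S : a ∈ F ∩ S
      a∈F∩S = x∈p∩q⁺ (a∈F , ∈-subset⁺ S? (inj₁ A.side-y))
      c∈F∩S : c ∈ F ∩ S
      c∈F∩S = x∈p∩q⁺ (c∈F , ∈-subset⁺ S? (inj₂ C.side-y))
      boundary : ∀ {z z′} → z ∈ S → z′ ∉ S → adj G z z′ ≡ true → z′ ∈ F → z ∈ F
      boundary z∈S z′∉S zz′ _ with ∈-subset⁻ S? z∈S
      ... | inj₁ a-side = subst (_∈ F) (≡.sym z≡a) a∈F
        where z≡a = proj₂ (A.crossing a-side (z′∉S ∘ ∈-subset⁺ S? ∘ inj₁) zz′)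
      ... | inj₂ c-side = subst (_∈ F) (≡.sym z≡c) c∈F
        where z≡c = proj₂ (C.crossing c-side (z′∉S ∘ ∈-subset⁺ S? ∘ inj₂) zz′)
      exterior : a ≢ c → ∀ {z e} → z ∉ S → ¬ OnlyNeighbourIn G (F ∩ S) z e
      exterior a≢c {z} z∉S (e∈F∩S , ze , only) =
        a≢c (trans (only a∈F∩S (x-adj xa)) (≡.sym (only c∈F∩S (x-adj xc))))
        where
        z≡x : z ≡ x
        z≡x with ∈-subset⁻ S? (proj₂ (x∈p∩q⁻ F S e∈F∩S))
        ... | inj₁ a-side = proj₁ (A.crossing a-side (z∉S ∘ ∈-subset⁺ S? ∘ inj₁) (adj-sym G ze))
        ... | inj₂ c-side = proj₁ (C.crossing c-side (z∉S ∘ ∈-subset⁺ S? ∘ inj₂) (adj-sym G ze))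
        x-adj : ∀ {b} → adj G x b ≡ true → adj G z b ≡ true
        x-adj {b} = subst (λ v → adj G v b ≡ true) (≡.sym z≡x)
      smaller-fort : a ≢ c → IsFort G (F ∩ S)
      smaller-fort a≢c = fort-∩ G fort (a , a∈F∩S) boundary (exterior a≢c)

infix 4 _⋖_
_⋖_ : ∀ {m} → Fin m → Fin m → Set
i ⋖ j = suc (toℕ i) ≡ toℕ j

⋖-unique : ∀ {m} {i j k : Fin m} → i ⋖ j → i ⋖ k → j ≡ k
⋖-unique i⋖j i⋖k = toℕ-injective (trans (≡.sym i⋖j) i⋖k)

⋖-uniqueˡ : ∀ {m} {i j k : Fin m} → i ⋖ k → j ⋖ k → i ≡ j
⋖-uniqueˡ i⋖k j⋖k = toℕ-injective (suc-injective (trans i⋖k (≡.sym j⋖k)))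

⋖⇒< : ∀ {m} {i j : Fin m} → i ⋖ j → i Fin.< j
⋖⇒< = ℕₚ.≤-reflexive

⋖-⋖⇒≢ : ∀ {m} {i j k : Fin m} → i ⋖ j → j ⋖ k → i ≢ k
⋖-⋖⇒≢ i⋖j j⋖k refl = ℕₚ.<-asym (⋖⇒< i⋖j) (⋖⇒< j⋖k)

¬fromℕ< : ∀ {m} {j : Fin (suc m)} → ¬ (Fin.fromℕ m Fin.< j)
¬fromℕ< {j = j} = ℕₚ.≤⇒≯ (≤fromℕ j)

predecessor? : ∀ {m} (x : Fin (suc m)) → x ≡ zero ⊎ ∃ (_⋖ x)
predecessor? zero    = inj₁ refl
predecessor? (suc x) = inj₂ (inject₁ x , cong suc (toℕ-inject₁ x))

successor? : ∀ {m} (x : Fin (suc m)) → x ≡ Fin.fromℕ m ⊎ ∃ (x ⋖_)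
successor? {m} x with m ℕₚ.≟ toℕ x
... | yes m≡x = inj₁ (toℕ-injective (trans (≡.sym m≡x) (≡.sym (toℕ-fromℕ m))))
... | no m≢x  = inj₂ (suc (Fin.lower₁ x m≢x) , cong suc (≡.sym (toℕ-lower₁ x m≢x)))

module _ {m} (P : Pred (Fin (suc m)) 0ℓ) where

  ⋖-induction-from : ∀ {i} → P i → (∀ {j k} → j ⋖ k → i Fin.≤ j → P j → P k) →
    ∀ {k} → i Fin.≤ k → P k
  ⋖-induction-from {i} Pi next {k} i≤k = go (toℕ k ∸ toℕ i) (ℕₚ.m∸n+n≡m i≤k)
    where
    go : ∀ d {k} → d + toℕ i ≡ toℕ k → P k
    go ℕ.zero     eq = subst P (toℕ-injective eq) Pi
    go (ℕ.suc d) {suc k} eq = next (cong suc (toℕ-inject₁ k)) i≤k′ (go d eq′)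
      where
      eq′ : d + toℕ i ≡ toℕ (inject₁ k)
      eq′ = trans (suc-injective eq) (≡.sym (toℕ-inject₁ k))
      i≤k′ : i Fin.≤ inject₁ k
      i≤k′ = subst (toℕ i ℕ.≤_) eq′ (ℕₚ.m≤n+m (toℕ i) d)

  ⋖-induction-downFrom : ∀ {k} → P k → (∀ {i j} → i ⋖ j → j Fin.≤ k → P j → P i) →
    ∀ {i} → i Fin.≤ k → P i
  ⋖-induction-downFrom {k} Pk next {i} i≤k = go (toℕ k ∸ toℕ i) (ℕₚ.m∸n+n≡m i≤k)
    where
    go : ∀ d {i} → d + toℕ i ≡ toℕ k → P i
    go ℕ.zero    eq = subst P (≡.sym (toℕ-injective eq)) Pk
    go (ℕ.suc d) {i} eq = next (≡.sym (toℕ-fromℕ< i+1<1+m)) j≤k (go d eq′)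
      where
      i+1≤k : suc (toℕ i) ℕ.≤ toℕ k
      i+1≤k = subst (suc (toℕ i) ℕ.≤_) eq (s≤s (ℕₚ.m≤n+m (toℕ i) d))
      i+1<1+m : suc (toℕ i) ℕ.< suc m
      i+1<1+m = s≤s (ℕₚ.≤-trans i+1≤k (toℕ≤pred[n] k))
      j = Fin.fromℕ< i+1<1+m
      eq′ : d + toℕ j ≡ toℕ k
      eq′ = trans (cong (d +_) (toℕ-fromℕ< i+1<1+m)) (trans (ℕₚ.+-suc d (toℕ i)) eq)
      j≤k : j Fin.≤ k
      j≤k = subst (toℕ j ℕ.≤_) eq′ (ℕₚ.m≤n+m (toℕ j) d)

-- IsPathGraph with the identity relabelling.
IsOrderedPath : ∀ {ℓ} → Graph (suc ℓ) → Set
IsOrderedPath P = ∀ i j → adj P i j ≡ true ⇔ (i ⋖ j ⊎ j ⋖ i)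

module OrderedPath {ℓ} (P : Graph (suc ℓ)) (ordered : IsOrderedPath P) where

  private
    adj⁺ : ∀ {i j} → i ⋖ j ⊎ j ⋖ i → adj P i j ≡ true
    adj⁺ = Equivalence.from (ordered _ _)

    adj⁻ : ∀ {i j} → adj P i j ≡ true → i ⋖ j ⊎ j ⋖ i
    adj⁻ = Equivalence.to (ordered _ _)

  fort-⋖ : ∀ {R j k} → IsFort P R → j ∉ R → j ⋖ k → k ∈ R → ¬ (∀ {i} → i ⋖ j → i ∉ R)
  fort-⋖ {R} {j} {k} fort j∉R j⋖k k∈R before∉R =
    fort⇒¬onlyNeighbour P fort j∉R (k∈R , adj⁺ (inj₁ j⋖k) , only)
    where
    only : ∀ {b} → b ∈ R → adj P j b ≡ true → b ≡ k
    only b∈R jb with adj⁻ jb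
    ... | inj₁ j⋖b = ⋖-unique j⋖b j⋖k
    ... | inj₂ b⋖j = ⊥-elim (before∉R b⋖j b∈R)

  fort-⋗ : ∀ {R i j} → IsFort P R → j ∉ R → i ⋖ j → i ∈ R → ¬ (∀ {k} → j ⋖ k → k ∉ R)
  fort-⋗ {R} {i} {j} fort j∉R i⋖j i∈R after∉R =
    fort⇒¬onlyNeighbour P fort j∉R (i∈R , adj⁺ (inj₂ i⋖j) , only)
    where
    only : ∀ {b} → b ∈ R → adj P j b ≡ true → b ≡ i
    only b∈R jb with adj⁻ jb
    ... | inj₁ j⋖b = ⊥-elim (after∉R j⋖b b∈R)
    ... | inj₂ b⋖j = ⋖-uniqueˡ b⋖j i⋖j

  -- Two consecutive gaps propagate to the right end and from there back to the left end.
  fort-no-gap : ∀ {R x} → IsFort P R → x ∉ R → ¬ (∀ {i} → i ⋖ x → i ∉ R)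
  fort-no-gap {R} {x} fort x∉R before∉R with proj₁ fort
  ... | k , k∈R = proj₁ (⋖-induction-downFrom Down top-down down-step (≤fromℕ k)) k∈R
    where
    Up Down : Pred (Fin (suc ℓ)) 0ℓ
    Up j   = j ∉ R × (∀ {i} → i ⋖ j → i ∉ R)
    Down j = j ∉ R × (∀ {k} → j ⋖ k → k ∉ R)
    up-step : ∀ {j k} → j ⋖ k → x Fin.≤ j → Up j → Up k
    up-step j⋖k _ (j∉R , before-j∉R) =
      (λ k∈R → fort-⋖ fort j∉R j⋖k k∈R before-j∉R) ,
      λ i⋖k → subst (_∉ R) (≡.sym (⋖-uniqueˡ i⋖k j⋖k)) j∉R
    top-down : Down (Fin.fromℕ ℓ)
    top-down = proj₁ (⋖-induction-from Up (x∉R , before∉R) up-step (≤fromℕ x)) ,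
               ⊥-elim ∘ ¬fromℕ< ∘ ⋖⇒<
    down-step : ∀ {i j} → i ⋖ j → j Fin.≤ Fin.fromℕ ℓ → Down j → Down i
    down-step i⋖j _ (j∉R , after∉R) =
      (λ i∈R → fort-⋗ fort j∉R i⋖j i∈R after∉R) ,
      λ i⋖k → subst (_∉ R) (⋖-unique i⋖j i⋖k) j∉R

  fort-predecessor : ∀ {R x} → IsFort P R → x ∉ R → ∃ λ p → p ⋖ x × p ∈ R
  fort-predecessor {R} {x} fort x∉R with predecessor? x
  ... | inj₁ refl = ⊥-elim (fort-no-gap fort x∉R λ ())
  ... | inj₂ (p , p⋖x) with p ∈? R
  ...   | yes p∈R = p , p⋖x , p∈R
  ...   | no p∉R  = ⊥-elim (fort-no-gap fort x∉R λ i⋖x → subst (_∉ R) (⋖-uniqueˡ p⋖x i⋖x) p∉R)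

  fort-successor : ∀ {R p x} → IsFort P R → x ∉ R → p ⋖ x → p ∈ R → ∃ λ s → x ⋖ s × s ∈ R
  fort-successor {R} {x = x} fort x∉R p⋖x p∈R with successor? x
  ... | inj₁ refl = ⊥-elim (fort-⋗ fort x∉R p⋖x p∈R (⊥-elim ∘ ¬fromℕ< ∘ ⋖⇒<))
  ... | inj₂ (s , x⋖s) with s ∈? R
  ...   | yes s∈R = s , x⋖s , s∈R
  ...   | no s∉R  = ⊥-elim (fort-⋗ fort x∉R p⋖x p∈R λ x⋖k → subst (_∉ R) (⋖-unique x⋖s x⋖k) s∉R)

  path-fort : ∀ {R} → zero ∈ R → Fin.fromℕ ℓ ∈ R → (∀ {i j} → i ⋖ j → i ∉ R → j ∉ R → ⊥) →
    IsFort P R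
  path-fort {R} 0∈R ℓ∈R no-gap = ¬onlyNeighbour⇒fort P (zero , 0∈R) ¬only
    where
    ¬only : ∀ {z a} → z ∉ R → ¬ OnlyNeighbourIn P R z a
    ¬only {z} z∉R (a∈R , za , only) with adj⁻ za
    ... | inj₁ z⋖a with predecessor? z
    ...   | inj₁ refl      = z∉R 0∈R
    ...   | inj₂ (p , p⋖z) = no-gap p⋖z (λ p∈R → ⋖-⋖⇒≢ p⋖z z⋖a (only p∈R (adj⁺ (inj₂ p⋖z)))) z∉R
    ¬only {z} z∉R (a∈R , za , only) | inj₂ a⋖z with successor? z
    ...   | inj₁ refl      = z∉R ℓ∈R
    ...   | inj₂ (s , z⋖s) =
      no-gap z⋖s z∉R (λ s∈R → ⋖-⋖⇒≢ a⋖z z⋖s (≡.sym (only s∈R (adj⁺ (inj₁ z⋖s)))))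

  path-minimalFort : ∀ {R} → IsFort P R →
    (∀ {i j k} → i ⋖ j → j ⋖ k → i ∈ R → j ∈ R → k ∈ R → ⊥) → IsMinimalFort P R
  path-minimalFort {R} fort no-triple = fort , smaller-not-fort
    where
    smaller-not-fort : ∀ R′ → R′ ⊂ R → ¬ IsFort P R′
    smaller-not-fort R′ (R′⊆R , x , x∈R , x∉R′) fort′ with fort-predecessor fort′ x∉R′
    ... | p , p⋖x , p∈R′ with fort-successor fort′ x∉R′ p⋖x p∈R′
    ...   | s , x⋖s , s∈R′ = no-triple p⋖x x⋖s (R′⊆R p∈R′) x∈R (R′⊆R s∈R′)

module PathIn {n} (G : Graph n) (acyclic : Acyclic G) {ℓ} {w : Fin (suc ℓ) → Fin n}
  (w-injective : Injective _≡_ _≡_ w)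
  (w-adjacent : ∀ (e : Fin ℓ) → adj G (w (inject₁ e)) (w (suc e)) ≡ true) where

  adj-⋖ : ∀ {i j} → i ⋖ j → adj G (w i) (w j) ≡ true
  adj-⋖ {j = suc e} i⋖j = subst (λ k → adj G (w k) (w (suc e)) ≡ true) inject₁e≡i (w-adjacent e)
    where
    inject₁e≡i = toℕ-injective (trans (toℕ-inject₁ e) (≡.sym (suc-injective i⋖j)))

  module _ {a b} (ab : adj G (w a) (w b) ≡ true) where
    open Sides G acyclic ab

    private
      w≢w : ∀ {i j} → toℕ i ≢ toℕ j → w i ≢ w j
      w≢w i≢j = i≢j ∘ cong toℕ ∘ w-injective

    side-between : ∀ {k} → a Fin.< k → k Fin.≤ b → Side (w k)
    side-between a<k k≤b =
      ⋖-induction-downFrom (λ k → a Fin.< k → Side (w k)) (λ _ → side-y) next k≤b a<k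
      where
      next : ∀ {i j} → i ⋖ j → j Fin.≤ b → (a Fin.< j → Side (w j)) → a Fin.< i → Side (w i)
      next i⋖j _ side-j a<i = side-step (side-j (ℕₚ.<-trans a<i (⋖⇒< i⋖j))) (adj-sym G (adj-⋖ i⋖j))
        (w≢w (ℕₚ.>⇒≢ a<i))

    side-after : a ⋖ b → ∀ {k} → b Fin.≤ k → Side (w k)
    side-after a⋖b = ⋖-induction-from (Side ∘ w) side-y next
      where
      next : ∀ {j k} → j ⋖ k → b Fin.≤ j → Side (w j) → Side (w k)
      next j⋖k b≤j side-j = side-step side-j (adj-⋖ j⋖k)
        (w≢w (ℕₚ.>⇒≢ (ℕₚ.<-trans (ℕₚ.<-≤-trans (⋖⇒< a⋖b) b≤j) (⋖⇒< j⋖k))))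

    ¬side-before : a Fin.< b → ∀ {k} → k Fin.≤ a → ¬ Side (w k)
    ¬side-before a<b = ⋖-induction-downFrom (¬_ ∘ Side ∘ w) ¬side-x next
      where
      next : ∀ {i j} → i ⋖ j → j Fin.≤ a → ¬ Side (w j) → ¬ Side (w i)
      next i⋖j j≤a ¬side-j side-i = w≢w (ℕₚ.<⇒≢ (ℕₚ.<-trans (ℕₚ.<-≤-trans (⋖⇒< i⋖j) j≤a) a<b))
        (proj₂ (crossing side-i ¬side-j (adj-⋖ i⋖j)))

  -- The successor of a is on b's side of the edge ab and adjacent to a, so by acyclicity it is b.
  adj⇒⋖ : ∀ {a b} → adj G (w a) (w b) ≡ true → a Fin.< b → a ⋖ b
  adj⇒⋖ {a} {b} ab a<b with successor? a
  ... | inj₁ refl       = ⊥-elim (¬fromℕ< a<b)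
  ... | inj₂ (s , a⋖s) = subst (a ⋖_) s≡b a⋖s
    where
    s≡b : s ≡ b
    s≡b = w-injective (Sides.side-adj-x G acyclic ab
      (side-between ab (⋖⇒< a⋖s) (subst (ℕ._≤ toℕ b) a⋖s a<b)) (adj-sym G (adj-⋖ a⋖s)))

  ordered : IsOrderedPath (induced G w)
  ordered i j = mk⇔ to [ adj-⋖ , adj-sym G ∘ adj-⋖ ]
    where
    to : adj G (w i) (w j) ≡ true → i ⋖ j ⊎ j ⋖ i
    to wiwj with ℕₚ.<-cmp (toℕ i) (toℕ j)
    ... | tri< i<j _ _ = inj₁ (adj⇒⋖ wiwj i<j)
    ... | tri≈ _ i≡j _ = ⊥-elim (adj⇒≢ G wiwj (cong w (toℕ-injective i≡j)))
    ... | tri> _ _ j<i = inj₂ (adj⇒⋖ (adj-sym G wiwj) j<i)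

theorem4p10 : ∀ {n} → 2 ≤ n → (T : Graph n) → IsTree T →
    (F : Subset n) → IsMinimalFort T F →
    (u v : Fin n) → u ∈ F → v ∈ F →
    (ℓ : ℕ) → (w : Fin (suc ℓ) → Fin n) → IsPath T u v ℓ w →
    IsPathGraph (induced T w) × IsMinimalFort (induced T w) (restrict F w)
theorem4p10 _ T (_ , acyclic) F minimal u v u∈F v∈F ℓ w (w-injective , refl , refl , w-adjacent) =
  (Permutation.id , ordered) ,
  path-minimalFort (path-fort (∈-restrict⁺ w u∈F) (∈-restrict⁺ w v∈F) no-gap) no-triple
  where
  open PathIn T acyclic w-injective w-adjacent
  open OrderedPath (induced T w) ordered
  R = restrict F w
  no-gap : ∀ {i j} → i ⋖ j → i ∉ R → j ∉ R → ⊥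
  no-gap {i} {j} i⋖j i∉R j∉R =
    minimalFort-side T acyclic minimal wiwj (i∉R ∘ ∈-restrict⁺ w) (j∉R ∘ ∈-restrict⁺ w) u∈F v∈F
      (¬side-before wiwj (⋖⇒< i⋖j) z≤n) (side-after wiwj i⋖j (≤fromℕ j))
    where
    wiwj = adj-⋖ i⋖j
  no-triple : ∀ {i j k} → i ⋖ j → j ⋖ k → i ∈ R → j ∈ R → k ∈ R → ⊥
  no-triple i⋖j j⋖k i∈R j∈R k∈R = ⋖-⋖⇒≢ i⋖j j⋖k (w-injective
    (minimalFort-neighbour-unique T acyclic minimal
      (∈-restrict⁻ w j∈R) (∈-restrict⁻ w i∈R) (∈-restrict⁻ w k∈R) (adj-sym T (adj-⋖ i⋖j)) (adj-⋖ j⋖k)))
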